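{- Let $n$ be a positive integer and let $(A_1,B_1),\ldots,(A_m,B_m)$ be pairs of subsets of $[n]=\{1,\ldots,n\}$ such that $A_i\cap B_i=\emptyset$ for all $1\le i\le m$, and $A_i\cap B_j\neq\emptyset$ for all $1\le i<j\le m$. Then $$\sum_{i=1}^m \frac{1}{\binom{|A_i|+|B_i|}{|A_i|}}\le n+1.$$ Moreover, in case of equality $B_i=[n]\setminus A_i$ holds for all $1\le i\le m$.
   Context: A collection of pairs as in the hypothesis is called a skew Bollobás system. -}

module Defs where

open import Data.Nat using (ℕ; zero; suc; _+_)
open import Data.Nat.Combinatorics using (_C_)
open import Data.Integer using (+_)
open import Data.Rational using (ℚ; 0ℚ; _/_) renaming (_+_ to _+ℚ_)
open import Data.Fin using (Fin; zero; suc)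
open import Data.Fin.Subset using (Subset; ∣_∣)

-- 1/k as a rational; the value at k = 0 is a dummy (never used: binomials are ≥ 1)
inv : ℕ → ℚ
inv zero    = 0ℚ
inv (suc k) = (+ 1) / suc k

sumℚ : (m : ℕ) → (Fin m → ℚ) → ℚ
sumℚ zero    f = 0ℚ
sumℚ (suc m) f = f zero +ℚ sumℚ m (λ i → f (suc i))

weight : {n : ℕ} → Subset n → Subset n → ℚ
weight A B = inv ((∣ A ∣ + ∣ B ∣) C ∣ A ∣)

-- Delete a point x from the ground set [n] and discard the pairs with x ∈ Aᵢ: the other
-- pairs, restricted to [n] ∖ {x}, again form a skew Bollobás system. If every Bᵢ is
-- nonempty, the weights of these n restricted systems add up to exactly n times the weight
-- of the original one: a pair with |A| = a and |B| = b + 1 contributes 1/C(a+b, a) for each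
-- of the b + 1 points of B and 1/C(a+b+1, a) for each of the n − a − b − 1 points outside
-- A ∪ B, and (b+1)/C(a+b, a) = (a+b+1)/C(a+b+1, a). By induction each restricted system
-- weighs at most n, so a system with all Bᵢ nonempty weighs at most n. In general only B₁
-- can be empty, since A₁ meets every later Bⱼ, and it adds weight 1: the bound n + 1.
-- Tracking when these bounds are strict shows that a point outside some Aᵢ ∪ Bᵢ makes the
-- inequality strict, which is the equality case.

module Submission where

open import Defs
open import Data.Nat using (ℕ; suc; NonZero)
open import Data.Integer using (+_)
open import Data.Rational using (ℚ; _≤_; _/_)
open import Data.Fin using (Fin; _<_)
open import Data.Fin.Subset using (Subset; _∩_; ∁; Empty; Nonempty)
open import Data.Product using (_×_)
open import Relation.Binary.PropositionalEquality using (_≡_)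

import Data.Rational.Properties as ℚP
open import Algebra.Bundles using (CommutativeMonoid)
open import Algebra.Properties.CommutativeMonoid.Mult ℚP.+-0-commutativeMonoid
  using () renaming (_×_ to _·_; ×-homo-+ to ·-homo-+; ×-distrib-+ to ·-distrib-+)
open import Algebra.Properties.CommutativeMonoid.Sum ℚP.+-0-commutativeMonoid
  using (sum; sum-syntax; sum-cong-≗; sum-replicate; ∑-distrib-+)
open import Algebra.Properties.CommutativeSemigroup (CommutativeMonoid.commutativeSemigroup ℚP.+-0-commutativeMonoid)
  using (x∙yz≈y∙xz)
open import Data.Bool using (if_then_else_)
open import Data.Empty using (⊥-elim)
open import Data.Fin using (zero; suc; punchIn; punchOut)
open import Data.Fin.Subset
  using (Side; inside; outside; _∈_; _∉_; _∪_; ⊥; ∣_∣)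
open import Data.Fin.Subset.Properties
  using (x∈p∩q⁺; x∈p∩q⁻; p∩q⊆q; x∈p∪q⁺; x∈∁p⇒x∉p; drop-∷-Empty; Empty-unique; ∣⊥∣≡0; nonempty?)
import Data.Integer as ℤ
import Data.Integer.Properties as ℤP
open import Data.List using (List; []; _∷_; tabulate)
open import Data.List.Relation.Unary.All as All using (All; []; _∷_)
import Data.List.Relation.Unary.All.Properties as All
open import Data.List.Relation.Unary.Any as Any using (Any; here; there)
import Data.List.Relation.Unary.Any.Properties as Any
open import Data.List.Relation.Unary.AllPairs using (AllPairs; []; _∷_)
import Data.List.Relation.Unary.AllPairs.Properties as AllPairs
import Data.Nat as ℕ
import Data.Nat.Properties as ℕP
open import Data.Nat.Combinatorics using (_C_)
open import Data.Product using (_,_; proj₁; proj₂; ∃-syntax; uncurry)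
import Data.Rational as ℚ
open import Data.Rational.Unnormalised as ℚᵘ using (mkℚᵘ; *≡*)
import Data.Rational.Unnormalised.Properties as ℚᵘP
open import Data.Sum using (_⊎_; inj₁; inj₂)
open import Data.Vec using (Vec; []; _∷_; here; lookup; removeAt; insertAt; map; zipWith)
open import Data.Vec.Properties using (insertAt-punchIn; insertAt-removeAt; removeAt-punchOut; []=⇒lookup; lookup⇒[]=)
open import Data.Vec.Functional using (Vector)
open import Function using (_∘_)
open import Relation.Binary.PropositionalEquality
  using (refl; sym; trans; cong; cong₂; subst; subst₂; _≢_; module ≡-Reasoning)
open import Relation.Nullary using (yes; no)

module Binomial where

  open import Data.Nat using (_+_; _*_; _∸_; _!)
  open import Data.Nat.Properties using (_!≢0; _!*_!≢0; m+n∸m≡n; m≤m+n; +-suc; +-identityʳ; *-assoc; *-cancelʳ-≡; m*n≢0⇒m≢0)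
  open import Data.Nat.Combinatorics using (k![n∸k]!∣n!; nCn≡1)
  open import Data.Nat.Combinatorics.Specification using (nCk≡n!/k![n-k]!)
  open import Data.Nat.DivMod using (m/n*n≡m)
  open import Data.Nat.Tactic.RingSolver using (solve-∀)
  open ≡-Reasoning

  binomial-factorials : ∀ a b → ((a + b) C a) * (a ! * b !) ≡ (a + b) !
  binomial-factorials a b = begin
    ((a + b) C a) * (a ! * b !)                                 ≡⟨ cong (λ c → ((a + b) C a) * (a ! * c !)) (m+n∸m≡n a b) ⟨
    ((a + b) C a) * (a ! * (a + b ∸ a) !)                       ≡⟨ cong (_* (a ! * (a + b ∸ a) !)) (nCk≡n!/k![n-k]! (m≤m+n a b)) ⟩
    (a + b) ! ℕ./ (a ! * (a + b ∸ a) !) * (a ! * (a + b ∸ a) !) ≡⟨ m/n*n≡m (k![n∸k]!∣n! (m≤m+n a b)) ⟩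
    (a + b) !                                                   ∎
    where instance _ = a !* (a + b ∸ a) !≢0

  binomial-nonZero : ∀ a b → NonZero ((a + b) C a)
  binomial-nonZero a b =
    m*n≢0⇒m≢0 ((a + b) C a) {{subst NonZero (sym (binomial-factorials a b)) ((a + b) !≢0)}}

  binomial-diagonal : ∀ a → (a + 0) C a ≡ 1
  binomial-diagonal a = trans (cong (_C a) (+-identityʳ a)) (nCn≡1 a)

  binomial-absorption : ∀ a b → suc b * ((a + suc b) C a) ≡ (a + suc b) * ((a + b) C a)
  binomial-absorption a b = *-cancelʳ-≡ _ _ (a ! * b !) {{a !* b !≢0}} (begin
    suc b * ((a + suc b) C a) * (a ! * b !)      ≡⟨ shuffle (suc b) ((a + suc b) C a) (a !) (b !) ⟩
    ((a + suc b) C a) * (a ! * suc b !)          ≡⟨ binomial-factorials a (suc b) ⟩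
    (a + suc b) !                                ≡⟨ cong _! (+-suc a b) ⟩
    suc (a + b) * (a + b) !                      ≡⟨ cong₂ _*_ (+-suc a b) (binomial-factorials a b) ⟨
    (a + suc b) * (((a + b) C a) * (a ! * b !))  ≡⟨ *-assoc (a + suc b) _ _ ⟨
    (a + suc b) * ((a + b) C a) * (a ! * b !)    ∎)
    where
    shuffle : ∀ s c p q → s * c * (p * q) ≡ c * (p * (s * q))
    shuffle = solve-∀

open Binomial using (binomial-nonZero; binomial-diagonal; binomial-absorption)
open import Data.Rational using (0ℚ; 1ℚ; _+_; fromℚᵘ; toℚᵘ)
open import Data.Integer.Tactic.RingSolver using (solve-∀)

-- Rational arithmetic

fromℚᵘ-homo-+ : ∀ p q → fromℚᵘ (p ℚᵘ.+ q) ≡ fromℚᵘ p + fromℚᵘ q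
fromℚᵘ-homo-+ p q = ℚP.toℚᵘ-injective (begin-equality
  toℚᵘ (fromℚᵘ (p ℚᵘ.+ q))              ≃⟨ ℚP.toℚᵘ-fromℚᵘ (p ℚᵘ.+ q) ⟩
  p ℚᵘ.+ q                              ≃⟨ ℚᵘP.+-cong (ℚP.toℚᵘ-fromℚᵘ p) (ℚP.toℚᵘ-fromℚᵘ q) ⟨
  toℚᵘ (fromℚᵘ p) ℚᵘ.+ toℚᵘ (fromℚᵘ q)  ≃⟨ ℚP.toℚᵘ-homo-+ (fromℚᵘ p) (fromℚᵘ q) ⟨
  toℚᵘ (fromℚᵘ p + fromℚᵘ q)            ∎)
  where open ℚᵘP.≤-Reasoning

·-inv : ∀ m d .{{_ : NonZero d}} → m · inv d ≡ (+ m) / d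
·-inv ℕ.zero  (suc d) = ℚP.fromℚᵘ-cong {mkℚᵘ (+ 0) 0} {mkℚᵘ (+ 0) d} (*≡* refl)
·-inv (suc m) (suc d) = begin
  inv (suc d) + m · inv (suc d)                  ≡⟨ cong (_+_ (inv (suc d))) (·-inv m (suc d)) ⟩
  fromℚᵘ (mkℚᵘ (+ 1) d) + fromℚᵘ (mkℚᵘ (+ m) d)  ≡⟨ fromℚᵘ-homo-+ (mkℚᵘ (+ 1) d) (mkℚᵘ (+ m) d) ⟨
  fromℚᵘ (mkℚᵘ (+ 1) d ℚᵘ.+ mkℚᵘ (+ m) d)        ≡⟨ ℚP.fromℚᵘ-cong {mkℚᵘ (+ 1) d ℚᵘ.+ mkℚᵘ (+ m) d} {mkℚᵘ (+ suc m) d}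
                                                      (*≡* (common-denominator (+ m) (+ suc d))) ⟩
  fromℚᵘ (mkℚᵘ (+ suc m) d)                      ∎
  where
  open ≡-Reasoning
  common-denominator : ∀ x s → (ℤ.1ℤ ℤ.* s ℤ.+ x ℤ.* s) ℤ.* s ≡ (ℤ.1ℤ ℤ.+ x) ℤ.* (s ℤ.* s)
  common-denominator = solve-∀

/-cross : ∀ m d m′ d′ .{{_ : NonZero d}} .{{_ : NonZero d′}} →
          m ℕ.* d′ ≡ m′ ℕ.* d → (+ m) / d ≡ (+ m′) / d′
/-cross m (suc d) m′ (suc d′) eq = ℚP.fromℚᵘ-cong {mkℚᵘ (+ m) d} {mkℚᵘ (+ m′) d′} (*≡* (begin
  + m ℤ.* + suc d′  ≡⟨ ℤP.pos-* m (suc d′) ⟨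
  + (m ℕ.* suc d′)  ≡⟨ cong +_ eq ⟩
  + (m′ ℕ.* suc d)  ≡⟨ ℤP.pos-* m′ (suc d) ⟩
  + m′ ℤ.* + suc d  ∎))
  where open ≡-Reasoning

inv-binomial-shift : ∀ a b → suc b · inv ((a ℕ.+ b) C a) ≡ (a ℕ.+ suc b) · inv ((a ℕ.+ suc b) C a)
inv-binomial-shift a b = begin
  suc b · inv ((a ℕ.+ b) C a)              ≡⟨ ·-inv (suc b) _ ⟩
  (+ suc b) / ((a ℕ.+ b) C a)              ≡⟨ /-cross (suc b) _ (a ℕ.+ suc b) _ (binomial-absorption a b) ⟩
  (+ (a ℕ.+ suc b)) / ((a ℕ.+ suc b) C a)  ≡⟨ ·-inv (a ℕ.+ suc b) _ ⟨
  (a ℕ.+ suc b) · inv ((a ℕ.+ suc b) C a)  ∎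
  where
  open ≡-Reasoning
  instance
    _ = binomial-nonZero a b
    _ = binomial-nonZero a (suc b)

·-monoʳ-≤ : ∀ n {p q} → p ≤ q → n · p ≤ n · q
·-monoʳ-≤ ℕ.zero  p≤q = ℚP.≤-refl
·-monoʳ-≤ (suc n) p≤q = ℚP.+-mono-≤ p≤q (·-monoʳ-≤ n p≤q)

·-monoʳ-< : ∀ n {p q} → p ℚ.< q → suc n · p ℚ.< suc n · q
·-monoʳ-< n p<q = ℚP.+-mono-<-≤ p<q (·-monoʳ-≤ n (ℚP.<⇒≤ p<q))

·-cancelʳ-≤ : ∀ n {p q} → suc n · p ≤ suc n · q → p ≤ q
·-cancelʳ-≤ n np≤nq = ℚP.≮⇒≥ (λ q<p → ℚP.<-irrefl refl (ℚP.<-≤-trans (·-monoʳ-< n q<p) np≤nq))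

·-cancelʳ-< : ∀ n {p q} → suc n · p ℚ.< suc n · q → p ℚ.< q
·-cancelʳ-< n np<nq = ℚP.≰⇒> (λ q≤p → ℚP.<-irrefl refl (ℚP.<-≤-trans np<nq (·-monoʳ-≤ (suc n) q≤p)))

·1-<-suc : ∀ n → n · 1ℚ ℚ.< suc n · 1ℚ
·1-<-suc n = subst (ℚ._< suc n · 1ℚ) (ℚP.+-identityˡ (n · 1ℚ))
  (ℚP.+-mono-<-≤ (ℚP.positive⁻¹ 1ℚ) (ℚP.≤-refl {n · 1ℚ}))

sum≤· : ∀ {n} {f : Vector ℚ n} {c} → (∀ i → f i ≤ c) → sum f ≤ n · c
sum≤· {ℕ.zero} f≤c = ℚP.≤-refl
sum≤· {suc n}  f≤c = ℚP.+-mono-≤ (f≤c zero) (sum≤· (f≤c ∘ suc))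

sum<· : ∀ {n} {f : Vector ℚ n} {c} → (∀ i → f i ≤ c) → ∀ i → f i ℚ.< c → sum f ℚ.< n · c
sum<· {suc n} f≤c zero    fi<c = ℚP.+-mono-<-≤ fi<c (sum≤· (f≤c ∘ suc))
sum<· {suc n} f≤c (suc i) fi<c = ℚP.+-mono-≤-< (f≤c zero) (sum<· (f≤c ∘ suc) i fi<c)

-- Deleting a point

module _ {a} {A : Set a} where

  lookup-removeAt : ∀ {n} (xs : Vec A (suc n)) i j → lookup (removeAt xs i) j ≡ lookup xs (punchIn i j)
  lookup-removeAt xs i j = begin
    lookup (removeAt xs i) j                                      ≡⟨ insertAt-punchIn (removeAt xs i) i (lookup xs i) j ⟨
    lookup (insertAt (removeAt xs i) i (lookup xs i)) (punchIn i j)  ≡⟨ cong (λ ys → lookup ys (punchIn i j)) (insertAt-removeAt xs i) ⟩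
    lookup xs (punchIn i j)                                       ∎
    where open ≡-Reasoning

  removeAt-map : ∀ {b} {B : Set b} {n} (f : A → B) (xs : Vec A (suc n)) i →
                 removeAt (map f xs) i ≡ map f (removeAt xs i)
  removeAt-map f (x ∷ xs)         zero    = refl
  removeAt-map f (x ∷ xs@(_ ∷ _)) (suc i) = cong (f x ∷_) (removeAt-map f xs i)

  removeAt-zipWith : ∀ {b c} {B : Set b} {C : Set c} {n} (f : A → B → C) (xs : Vec A (suc n)) ys i →
                     removeAt (zipWith f xs ys) i ≡ zipWith f (removeAt xs i) (removeAt ys i)
  removeAt-zipWith f (x ∷ xs)         (y ∷ ys)         zero    = refl
  removeAt-zipWith f (x ∷ xs@(_ ∷ _)) (y ∷ ys@(_ ∷ _)) (suc i) = cong (f x y ∷_) (removeAt-zipWith f xs ys i)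

lookup≡outside⇒∉ : ∀ {n} {p : Subset n} {x} → lookup p x ≡ outside → x ∉ p
lookup≡outside⇒∉ eq x∈p with trans (sym ([]=⇒lookup x∈p)) eq
... | ()

∈-removeAt⁻ : ∀ {n} {p : Subset (suc n)} {i j} → j ∈ removeAt p i → punchIn i j ∈ p
∈-removeAt⁻ {p = p} {i} {j} j∈ = lookup⇒[]= _ p (trans (sym (lookup-removeAt p i j)) ([]=⇒lookup j∈))

∈-removeAt⁺ : ∀ {n} {p : Subset (suc n)} {i j} (i≢j : i ≢ j) → j ∈ p → punchOut i≢j ∈ removeAt p i
∈-removeAt⁺ {p = p} i≢j j∈p = lookup⇒[]= _ _ (trans (removeAt-punchOut p i≢j) ([]=⇒lookup j∈p))

Empty-removeAt : ∀ {n} {p : Subset (suc n)} {i} → Empty p → Empty (removeAt p i)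
Empty-removeAt p≡∅ (j , j∈) = p≡∅ (_ , ∈-removeAt⁻ j∈)

Nonempty-removeAt : ∀ {n} {p : Subset (suc n)} {i j} → i ≢ j → j ∈ p → Nonempty (removeAt p i)
Nonempty-removeAt i≢j j∈p = _ , ∈-removeAt⁺ i≢j j∈p

∣p∣≡1+∣removeAt∣ : ∀ {n} (p : Subset (suc n)) i → lookup p i ≡ inside → ∣ p ∣ ≡ suc ∣ removeAt p i ∣
∣p∣≡1+∣removeAt∣ (inside  ∷ p)         zero    refl = refl
∣p∣≡1+∣removeAt∣ (inside  ∷ p@(_ ∷ _)) (suc i) eq   = cong suc (∣p∣≡1+∣removeAt∣ p i eq)
∣p∣≡1+∣removeAt∣ (outside ∷ p@(_ ∷ _)) (suc i) eq   = ∣p∣≡1+∣removeAt∣ p i eq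

∣removeAt∣≡∣p∣ : ∀ {n} (p : Subset (suc n)) i → lookup p i ≡ outside → ∣ removeAt p i ∣ ≡ ∣ p ∣
∣removeAt∣≡∣p∣ (outside ∷ p)         zero    refl = refl
∣removeAt∣≡∣p∣ (inside  ∷ p@(_ ∷ _)) (suc i) eq   = cong suc (∣removeAt∣≡∣p∣ p i eq)
∣removeAt∣≡∣p∣ (outside ∷ p@(_ ∷ _)) (suc i) eq   = ∣removeAt∣≡∣p∣ p i eq

module _ {n : ℕ} {p q : Subset n} where

  ∈∁∪⇒∉ : ∀ {x} → x ∈ ∁ (p ∪ q) → x ∉ p × x ∉ q
  ∈∁∪⇒∉ x∈ = (λ x∈p → x∈∁p⇒x∉p x∈ (x∈p∪q⁺ (inj₁ x∈p))) , (λ x∈q → x∈∁p⇒x∉p x∈ (x∈p∪q⁺ (inj₂ x∈q)))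

  ∉-disjoint : Empty (p ∩ q) → ∀ {x} → x ∈ q → x ∉ p
  ∉-disjoint p∩q≡∅ x∈q x∈p = p∩q≡∅ (_ , x∈p∩q⁺ (x∈p , x∈q))

∣p∣+∣q∣+∣∁p∪q∣≡n : ∀ {n} (p q : Subset n) → Empty (p ∩ q) → ∣ p ∣ ℕ.+ ∣ q ∣ ℕ.+ ∣ ∁ (p ∪ q) ∣ ≡ n
∣p∣+∣q∣+∣∁p∪q∣≡n []            []            _  = refl
∣p∣+∣q∣+∣∁p∪q∣≡n (inside  ∷ p) (inside  ∷ q) ∅ = ⊥-elim (∅ (zero , here))
∣p∣+∣q∣+∣∁p∪q∣≡n (inside  ∷ p) (outside ∷ q) ∅ = cong suc (∣p∣+∣q∣+∣∁p∪q∣≡n p q (drop-∷-Empty ∅))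
∣p∣+∣q∣+∣∁p∪q∣≡n (outside ∷ p) (inside  ∷ q) ∅ =
  trans (cong (ℕ._+ ∣ ∁ (p ∪ q) ∣) (ℕP.+-suc ∣ p ∣ ∣ q ∣)) (cong suc (∣p∣+∣q∣+∣∁p∪q∣≡n p q (drop-∷-Empty ∅)))
∣p∣+∣q∣+∣∁p∪q∣≡n (outside ∷ p) (outside ∷ q) ∅ =
  trans (ℕP.+-suc (∣ p ∣ ℕ.+ ∣ q ∣) ∣ ∁ (p ∪ q) ∣) (cong suc (∣p∣+∣q∣+∣∁p∪q∣≡n p q (drop-∷-Empty ∅)))

disjoint-cover⇒≡∁ : ∀ {n} (p q : Subset n) → Empty (p ∩ q) → Empty (∁ (p ∪ q)) → q ≡ ∁ p
disjoint-cover⇒≡∁ []            []            _ _ = refl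
disjoint-cover⇒≡∁ (inside  ∷ p) (inside  ∷ q) ∅ _ = ⊥-elim (∅ (zero , here))
disjoint-cover⇒≡∁ (inside  ∷ p) (outside ∷ q) ∅ ∅′ =
  cong (outside ∷_) (disjoint-cover⇒≡∁ p q (drop-∷-Empty ∅) (drop-∷-Empty ∅′))
disjoint-cover⇒≡∁ (outside ∷ p) (inside  ∷ q) ∅ ∅′ =
  cong (inside ∷_) (disjoint-cover⇒≡∁ p q (drop-∷-Empty ∅) (drop-∷-Empty ∅′))
disjoint-cover⇒≡∁ (outside ∷ p) (outside ∷ q) _ ∅′ = ⊥-elim (∅′ (zero , here))

-- What a point x contributes to the restriction at x of a pair (A , B), according to
-- whether x lies in A, in B or in neither.
byClass : ℚ → ℚ → Side → Side → ℚ
byClass u v inside  _       = 0ℚ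
byClass u v outside inside  = u
byClass u v outside outside = v

sum-byClass : ∀ {n} (A B : Subset n) → Empty (A ∩ B) → ∀ u v →
              ∑[ x < n ] byClass u v (lookup A x) (lookup B x) ≡ ∣ B ∣ · u + ∣ ∁ (A ∪ B) ∣ · v
sum-byClass []            []            _ u v = refl
sum-byClass (inside  ∷ A) (inside  ∷ B) ∅ u v = ⊥-elim (∅ (zero , here))
sum-byClass (inside  ∷ A) (outside ∷ B) ∅ u v = trans (ℚP.+-identityˡ _) (sum-byClass A B (drop-∷-Empty ∅) u v)
sum-byClass (outside ∷ A) (inside  ∷ B) ∅ u v =
  trans (cong (_+_ u) (sum-byClass A B (drop-∷-Empty ∅) u v)) (sym (ℚP.+-assoc u _ _))
sum-byClass (outside ∷ A) (outside ∷ B) ∅ u v =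
  trans (cong (_+_ v) (sum-byClass A B (drop-∷-Empty ∅) u v)) (x∙yz≈y∙xz v (∣ B ∣ · u) (∣ ∁ (A ∪ B) ∣ · v))

-- Skew Bollobás systems

Pair : ℕ → Set
Pair n = Subset n × Subset n

Disjoint : ∀ {n} → Pair n → Set
Disjoint (A , B) = Empty (A ∩ B)

Precedes : ∀ {n} → Pair n → Pair n → Set
Precedes (A , _) (_ , B) = Nonempty (A ∩ B)

IsSkewSystem : ∀ {n} → List (Pair n) → Set
IsSkewSystem ps = All Disjoint ps × AllPairs Precedes ps

Uncovered : ∀ {n} → Pair n → Set
Uncovered (A , B) = Nonempty (∁ (A ∪ B))

NonemptyWithout : ∀ {n} → Fin n → Pair n → Set
NonemptyWithout y (_ , B) = ∃[ z ] y ≢ z × z ∈ B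

totalWeight : ∀ {n} → List (Pair n) → ℚ
totalWeight []       = 0ℚ
totalWeight (p ∷ ps) = uncurry weight p + totalWeight ps

sumℚ≡totalWeight : ∀ {n} m (f : Fin m → Pair n) → sumℚ m (uncurry weight ∘ f) ≡ totalWeight (tabulate f)
sumℚ≡totalWeight ℕ.zero  f = refl
sumℚ≡totalWeight (suc m) f = cong (_+_ (uncurry weight (f zero))) (sumℚ≡totalWeight m (f ∘ suc))

weight-∅ : ∀ {n} (A : Subset n) → weight A ⊥ ≡ 1ℚ
weight-∅ {n} A = cong inv (trans (cong (λ b → (∣ A ∣ ℕ.+ b) C ∣ A ∣) (∣⊥∣≡0 n)) (binomial-diagonal ∣ A ∣))

restrict : ∀ {k} → Fin (suc k) → Pair (suc k) → Pair k
restrict x (A , B) = removeAt A x , removeAt B x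

restrictAt : ∀ {k} → Fin (suc k) → List (Pair (suc k)) → List (Pair k)
restrictAt x []             = []
restrictAt x ((A , B) ∷ ps) =
  if lookup A x then restrictAt x ps else restrict x (A , B) ∷ restrictAt x ps

restrictedWeight : ∀ {k} → Fin (suc k) → Pair (suc k) → ℚ
restrictedWeight x (A , B) = if lookup A x then 0ℚ else uncurry weight (restrict x (A , B))

module _ {k} (x : Fin (suc k)) where

  totalWeight-restrictAt : ∀ p ps →
    totalWeight (restrictAt x (p ∷ ps)) ≡ restrictedWeight x p + totalWeight (restrictAt x ps)
  totalWeight-restrictAt (A , B) ps with lookup A x
  ... | inside  = sym (ℚP.+-identityˡ _)
  ... | outside = refl

  All-restrictAt : ∀ {P : Pair (suc k) → Set} {Q : Pair k → Set} →
    (∀ {p} → x ∉ proj₁ p → P p → Q (restrict x p)) →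
    ∀ {ps} → All P ps → All Q (restrictAt x ps)
  All-restrictAt f                 []       = []
  All-restrictAt f {(A , _) ∷ _} (h ∷ hs) with lookup A x in eq
  ... | inside  = All-restrictAt f hs
  ... | outside = f (lookup≡outside⇒∉ eq) h ∷ All-restrictAt f hs

  AllPairs-restrictAt : ∀ {R : Pair (suc k) → Pair (suc k) → Set} {S : Pair k → Pair k → Set} →
    (∀ {p q} → x ∉ proj₁ p → R p q → S (restrict x p) (restrict x q)) →
    ∀ {ps} → AllPairs R ps → AllPairs S (restrictAt x ps)
  AllPairs-restrictAt f                 []       = []
  AllPairs-restrictAt f {(A , _) ∷ _} (h ∷ hs) with lookup A x in eq
  ... | inside  = AllPairs-restrictAt f hs
  ... | outside = All-restrictAt (λ _ → f (lookup≡outside⇒∉ eq)) h ∷ AllPairs-restrictAt f hs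

  restrictAt-here : ∀ {Q : Pair k → Set} {A B ps} → x ∉ A → Q (restrict x (A , B)) →
    Any Q (restrictAt x ((A , B) ∷ ps))
  restrictAt-here {A = A} x∉A q with lookup A x in eq
  ... | inside  = ⊥-elim (x∉A (lookup⇒[]= x A eq))
  ... | outside = here q

  restrictAt-there : ∀ {Q : Pair k → Set} {p ps} → Any Q (restrictAt x ps) → Any Q (restrictAt x (p ∷ ps))
  restrictAt-there {p = A , _} q with lookup A x
  ... | inside  = q
  ... | outside = there q

  Disjoint-restrict : ∀ {p} → Disjoint p → Disjoint (restrict x p)
  Disjoint-restrict {A , B} A∩B≡∅ = subst Empty (removeAt-zipWith _ A B x) (Empty-removeAt A∩B≡∅)

  Precedes-restrict : ∀ {p q} → x ∉ proj₁ p → Precedes p q → Precedes (restrict x p) (restrict x q)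
  Precedes-restrict {A , _} {_ , B} x∉A (z , z∈A∩B) =
    subst Nonempty (removeAt-zipWith _ A B x) (Nonempty-removeAt x≢z z∈A∩B)
    where
    x≢z : x ≢ z
    x≢z refl = x∉A (proj₁ (x∈p∩q⁻ A B z∈A∩B))

  Uncovered-restrict : ∀ {A B y} → x ≢ y → y ∈ ∁ (A ∪ B) → Uncovered (restrict x (A , B))
  Uncovered-restrict {A} {B} x≢y y∈ = subst Nonempty removeAt-∁∪ (Nonempty-removeAt x≢y y∈)
    where
    removeAt-∁∪ : removeAt (∁ (A ∪ B)) x ≡ ∁ (removeAt A x ∪ removeAt B x)
    removeAt-∁∪ = trans (removeAt-map _ (A ∪ B) x) (cong ∁ (removeAt-zipWith _ A B x))

  IsSkewSystem-restrictAt : ∀ {ps} → IsSkewSystem ps → IsSkewSystem (restrictAt x ps)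
  IsSkewSystem-restrictAt (disjoint , skew) =
    All-restrictAt (λ _ → Disjoint-restrict) disjoint ,
    AllPairs-restrictAt (λ {p} {q} → Precedes-restrict {p} {q}) skew

sum-restrictedWeight : ∀ {k} (p : Pair (suc k)) → Disjoint p → Nonempty (proj₂ p) →
  ∑[ x < suc k ] restrictedWeight x p ≡ suc k · uncurry weight p
sum-restrictedWeight {k} (A , B) A∩B≡∅ (z , z∈B) = begin
  ∑[ x < suc k ] restrictedWeight x (A , B)             ≡⟨ sum-cong-≗ restrictedWeight≡byClass ⟩
  ∑[ x < suc k ] byClass u v (lookup A x) (lookup B x)  ≡⟨ sum-byClass A B A∩B≡∅ u v ⟩
  ∣ B ∣ · u + c · v                                      ≡⟨ cong (λ m → m · u + c · v) ∣B∣≡1+b ⟩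
  suc b · u + c · v                                      ≡⟨ cong (λ w → w + c · v) (inv-binomial-shift a b) ⟩
  (a ℕ.+ suc b) · v + c · v                             ≡⟨ ·-homo-+ v (a ℕ.+ suc b) c ⟨
  (a ℕ.+ suc b ℕ.+ c) · v                               ≡⟨ cong (λ m → (a ℕ.+ m ℕ.+ c) · v) ∣B∣≡1+b ⟨
  (a ℕ.+ ∣ B ∣ ℕ.+ c) · v                               ≡⟨ cong (_· v) (∣p∣+∣q∣+∣∁p∪q∣≡n A B A∩B≡∅) ⟩
  suc k · v                                              ≡⟨ cong (λ m → suc k · inv ((a ℕ.+ m) C a)) ∣B∣≡1+b ⟨
  suc k · weight A B                                     ∎
  where
  open ≡-Reasoning
  a = ∣ A ∣
  b = ∣ removeAt B z ∣
  c = ∣ ∁ (A ∪ B) ∣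
  u = inv ((a ℕ.+ b) C a)
  v = inv ((a ℕ.+ suc b) C a)

  ∣B∣≡1+b : ∣ B ∣ ≡ suc b
  ∣B∣≡1+b = ∣p∣≡1+∣removeAt∣ B z ([]=⇒lookup z∈B)

  restrictedWeight≡byClass : ∀ x → restrictedWeight x (A , B) ≡ byClass u v (lookup A x) (lookup B x)
  restrictedWeight≡byClass x with lookup A x in A[x] | lookup B x in B[x]
  ... | inside  | _       = refl
  ... | outside | inside  = cong₂ (λ a′ b′ → inv ((a′ ℕ.+ b′) C a′)) (∣removeAt∣≡∣p∣ A x A[x])
                              (ℕP.suc-injective (trans (sym (∣p∣≡1+∣removeAt∣ B x B[x])) ∣B∣≡1+b))
  ... | outside | outside = cong₂ (λ a′ b′ → inv ((a′ ℕ.+ b′) C a′)) (∣removeAt∣≡∣p∣ A x A[x])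
                              (trans (∣removeAt∣≡∣p∣ B x B[x]) ∣B∣≡1+b)

sum-totalWeight-restrictAt : ∀ {k} (ps : List (Pair (suc k))) → All Disjoint ps → All (Nonempty ∘ proj₂) ps →
  ∑[ x < suc k ] totalWeight (restrictAt x ps) ≡ suc k · totalWeight ps
sum-totalWeight-restrictAt {k} []       []       []         = sum-replicate (suc k) {0ℚ}
sum-totalWeight-restrictAt {k} (p ∷ ps) (d ∷ ds) (ne ∷ nes) = begin
  ∑[ x < suc k ] totalWeight (restrictAt x (p ∷ ps))
    ≡⟨ sum-cong-≗ (λ x → totalWeight-restrictAt x p ps) ⟩
  ∑[ x < suc k ] (restrictedWeight x p + totalWeight (restrictAt x ps))
    ≡⟨ ∑-distrib-+ (λ x → restrictedWeight x p) (λ x → totalWeight (restrictAt x ps)) ⟩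
  ∑[ x < suc k ] restrictedWeight x p + ∑[ x < suc k ] totalWeight (restrictAt x ps)
    ≡⟨ cong₂ _+_ (sum-restrictedWeight p d ne) (sum-totalWeight-restrictAt ps ds nes) ⟩
  suc k · uncurry weight p + suc k · totalWeight ps
    ≡⟨ ·-distrib-+ (uncurry weight p) (totalWeight ps) (suc k) ⟨
  suc k · totalWeight (p ∷ ps)
    ∎
  where open ≡-Reasoning

uncovered-restrictAt : ∀ {k} {ps : List (Pair (suc k))} → All Disjoint ps → All (Nonempty ∘ proj₂) ps →
  Any Uncovered ps → ∃[ x ] Any Uncovered (restrictAt x ps)
uncovered-restrictAt {ps = (A , B) ∷ ps} (A∩B≡∅ ∷ _) ((x , x∈B) ∷ _) (here (y , y∈)) =
  x , restrictAt-here x {B = B} {ps} (∉-disjoint {p = A} A∩B≡∅ x∈B) (Uncovered-restrict x {A} {B} x≢y y∈)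
  where
  x≢y : x ≢ y
  x≢y refl = proj₂ (∈∁∪⇒∉ {p = A} y∈) x∈B
uncovered-restrictAt {ps = p ∷ ps} (_ ∷ ds) (_ ∷ nes) (there uncovered) =
  let x , uncovered′ = uncovered-restrictAt ds nes uncovered in x , restrictAt-there x {p = p} {ps} uncovered′

0≤·1 : ∀ n → 0ℚ ≤ n · 1ℚ
0≤·1 ℕ.zero  = ℚP.≤-refl
0≤·1 (suc n) = ℚP.<⇒≤ (ℚP.≤-<-trans (0≤·1 n) (·1-<-suc n))

Slack : ∀ {n} → List (Pair n) → Set
Slack ps = Any Uncovered ps ⊎ ∃[ y ] All (NonemptyWithout y) ps

NonemptyWeightBound : ℕ → Set
NonemptyWeightBound n = ∀ (ps : List (Pair n)) → IsSkewSystem ps → All (Nonempty ∘ proj₂) ps →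
  totalWeight ps ≤ n · 1ℚ × (Slack ps → totalWeight ps ℚ.< n · 1ℚ)

WeightBound : ℕ → Set
WeightBound n = ∀ (ps : List (Pair n)) → IsSkewSystem ps →
  totalWeight ps ≤ suc n · 1ℚ × (Any Uncovered ps → totalWeight ps ℚ.< suc n · 1ℚ)

nonemptyWeightBound-zero : NonemptyWeightBound 0
nonemptyWeightBound-zero []      _ _              = ℚP.≤-refl , λ { (inj₁ ()) ; (inj₂ (() , _)) }
nonemptyWeightBound-zero (_ ∷ _) _ ((() , _) ∷ _)

nonemptyWeightBound-suc : ∀ {k} → WeightBound k → NonemptyWeightBound k → NonemptyWeightBound (suc k)
nonemptyWeightBound-suc {k} bound nonemptyBound ps system@(disjoint , _) nonempty =
  ·-cancelʳ-≤ k (subst (_≤ suc k · (suc k · 1ℚ)) averaged (sum≤· restricted≤)) ,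
  λ slack → let x , x< = strictAt slack in
    ·-cancelʳ-< k (subst (ℚ._< suc k · (suc k · 1ℚ)) averaged (sum<· restricted≤ x x<))
  where
  averaged : ∑[ x < suc k ] totalWeight (restrictAt x ps) ≡ suc k · totalWeight ps
  averaged = sum-totalWeight-restrictAt ps disjoint nonempty

  restricted : ∀ x → IsSkewSystem (restrictAt x ps)
  restricted x = IsSkewSystem-restrictAt x system

  restricted≤ : ∀ x → totalWeight (restrictAt x ps) ≤ suc k · 1ℚ
  restricted≤ x = proj₁ (bound _ (restricted x))

  strictAt : Slack ps → ∃[ x ] totalWeight (restrictAt x ps) ℚ.< suc k · 1ℚ
  strictAt (inj₁ uncovered) =
    let x , uncovered′ = uncovered-restrictAt disjoint nonempty uncovered in
    x , proj₂ (bound _ (restricted x)) uncovered′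
  strictAt (inj₂ (y , nonemptyWithout)) =
    y , ℚP.≤-<-trans (proj₁ (nonemptyBound _ (restricted y) nonempty′)) (·1-<-suc k)
    where
    nonempty′ = All-restrictAt y (λ _ (_ , y≢z , z∈B) → Nonempty-removeAt y≢z z∈B) nonemptyWithout

All-Precedes⇒Nonempty : ∀ {n} {p : Pair n} {ps} → All (Precedes p) ps → All (Nonempty ∘ proj₂) ps
All-Precedes⇒Nonempty {p = A , _} = All.map λ { {_ , B} (z , z∈A∩B) → z , p∩q⊆q A B z∈A∩B }

nonempty⇒weightBound : ∀ {n} → NonemptyWeightBound n → WeightBound n
nonempty⇒weightBound {n} bound []             _ = 0≤·1 (suc n) , λ ()
nonempty⇒weightBound {n} bound ((A , B) ∷ ps) (A∩B≡∅ ∷ disjoint , precedes ∷ skew) with nonempty? B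
... | yes B≢∅ = ℚP.<⇒≤ below , λ _ → below
  where
  below : totalWeight ((A , B) ∷ ps) ℚ.< suc n · 1ℚ
  below = ℚP.≤-<-trans
    (proj₁ (bound _ (A∩B≡∅ ∷ disjoint , precedes ∷ skew) (B≢∅ ∷ All-Precedes⇒Nonempty {p = A , B} precedes)))
    (·1-<-suc n)
... | no B≡∅ = subst (_≤ suc n · 1ℚ) (sym total≡) (ℚP.+-monoʳ-≤ 1ℚ (proj₁ rest)) ,
               λ uncovered → subst (ℚ._< suc n · 1ℚ) (sym total≡) (ℚP.+-monoʳ-< 1ℚ (proj₂ rest (slack uncovered)))
  where
  rest = bound ps (disjoint , skew) (All-Precedes⇒Nonempty {p = A , B} precedes)
  total≡ : totalWeight ((A , B) ∷ ps) ≡ 1ℚ + totalWeight ps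
  total≡ = cong (λ w → w + totalWeight ps) (trans (cong (weight A) (Empty-unique B≡∅)) (weight-∅ A))
  -- A later B′ meets A, and A avoids every uncovered point of (A , B).
  slack : Any Uncovered ((A , B) ∷ ps) → Slack ps
  slack (here (y , y∈)) = inj₂ (y , All.map (λ { {_ , B′} (z , z∈A∩B′) →
    z , (λ { refl → proj₁ (∈∁∪⇒∉ {p = A} y∈) (proj₁ (x∈p∩q⁻ A B′ z∈A∩B′)) }) , p∩q⊆q A B′ z∈A∩B′ }) precedes)
  slack (there uncovered) = inj₁ uncovered

nonemptyWeightBound : ∀ n → NonemptyWeightBound n
nonemptyWeightBound ℕ.zero  = nonemptyWeightBound-zero
nonemptyWeightBound (suc k) =
  nonemptyWeightBound-suc (nonempty⇒weightBound (nonemptyWeightBound k)) (nonemptyWeightBound k)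

weightBound : ∀ n → WeightBound n
weightBound n = nonempty⇒weightBound (nonemptyWeightBound n)

-- The bound also holds for n = 0.
theorem3 : (n : ℕ) → .{{_ : NonZero n}} → (m : ℕ) → (A B : Fin m → Subset n) →
    (∀ i → Empty (A i ∩ B i)) →
    (∀ i j → i < j → Nonempty (A i ∩ B j)) →
    (sumℚ m (λ i → weight (A i) (B i)) ≤ (+ suc n) / 1)
    × (sumℚ m (λ i → weight (A i) (B i)) ≡ (+ suc n) / 1 → ∀ i → B i ≡ ∁ (A i))
theorem3 n m A B disjoint skew =
  subst₂ _≤_ (sym total≡) bound≡ (proj₁ bounds) ,
  λ total≡bound i → disjoint-cover⇒≡∁ (A i) (B i) (disjoint i) λ uncovered →
    ℚP.<-irrefl (trans (sym total≡) (trans total≡bound (sym bound≡)))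
      (proj₂ bounds (Any.tabulate⁺ i uncovered))
  where
  ps = tabulate (λ i → A i , B i)
  total≡ : sumℚ m (λ i → weight (A i) (B i)) ≡ totalWeight ps
  total≡ = sumℚ≡totalWeight m (λ i → A i , B i)
  bound≡ : suc n · 1ℚ ≡ (+ suc n) / 1
  bound≡ = ·-inv (suc n) 1
  bounds = weightBound n ps (All.tabulate⁺ disjoint , AllPairs.tabulate⁺-< (skew _ _))
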